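{- There exists a symmetric Hadamard matrix of order $452 = 4\cdot 113$, i.e. a matrix $H$ of order $452$ with all entries in $\{1,-1\}$ such that $H = H^T$ and $HH^T = 452\, I_{452}$.
   Context: $I_m$ denotes the identity matrix of order $m$ and $H^T$ the transpose of $H$. -}

module Defs where

open import Data.Nat using (ℕ)
open import Data.Fin using (Fin; _≟_)
open import Data.Integer using (ℤ; +_; -_; _*_; _+_; 0ℤ; 1ℤ)
open import Data.Product using (_×_)
open import Data.Sum using (_⊎_)
open import Relation.Nullary using (yes; no)
open import Relation.Binary.PropositionalEquality using (_≡_)

Matrix : ℕ → Set
Matrix n = Fin n → Fin n → ℤ

∑ : (n : ℕ) → (Fin n → ℤ) → ℤ
∑ ℕ.zero f = 0ℤ
∑ (ℕ.suc n) f = f Fin.zero + ∑ n (λ i → f (Fin.suc i))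

transpose : {n : ℕ} → Matrix n → Matrix n
transpose H i j = H j i

_⊗_ : {n : ℕ} → Matrix n → Matrix n → Matrix n
_⊗_ {n} A B i j = ∑ n (λ k → A i k * B k j)

identity : {n : ℕ} → Matrix n
identity i j with i ≟ j
... | yes _ = 1ℤ
... | no _ = 0ℤ

scale : {n : ℕ} → ℤ → Matrix n → Matrix n
scale c A i j = c * A i j

PlusMinusOne : {n : ℕ} → Matrix n → Set
PlusMinusOne H = ∀ i j → (H i j ≡ 1ℤ) ⊎ (H i j ≡ - 1ℤ)

IsHadamard : (n : ℕ) → Matrix n → Set
IsHadamard n H = PlusMinusOne H × (∀ i j → (H ⊗ transpose H) i j ≡ scale (+ n) identity i j)

IsSymmetric : {n : ℕ} → Matrix n → Set
IsSymmetric H = ∀ i j → H i j ≡ transpose H i j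

IsSymmetricHadamard : (n : ℕ) → Matrix n → Set
IsSymmetricHadamard n H = IsHadamard n H × IsSymmetric H

module Submission where

-- H is a 4 × 4 array of ± circulant and ± back-circulant blocks of order 113 (a propus-type array)
-- built from ±1 sequences a, b, d of length 113 and the reversals of b and d, with a symmetric.
-- Back-circulant blocks are symmetric, and so are circulant blocks of a symmetric sequence, so the
-- symmetric array gives a symmetric matrix. The inner product of row x of one block with row y of
-- another is a periodic correlation of their sequences at a lag that depends only on x − y when
-- the blocks have the same shape, and only on x + y otherwise. Hence every entry of H Hᵀ splits
-- into a part depending on x − y and a part depending on x + y, and H Hᵀ = 452 I reduces to
-- finitely many identities between periodic correlations, which are checked by evaluation.

open import Agda.Builtin.String using (primStringEquality)
open import Data.Bool.Base using (Bool; true; false; if_then_else_)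
open import Data.Char.Base using (Char)
open import Data.Empty using (⊥-elim)
open import Data.Fin.Base using (Fin; zero; suc; toℕ; inject₁; fromℕ; combine; remQuot; _↑ˡ_; _↑ʳ_)
open import Data.Fin.Patterns using (0F; 1F; 2F; 3F)
open import Data.Fin.Properties
  using ( _≟_; all?; remQuot-combine; combine-remQuot; combine-injective
        ; toℕ<n; toℕ-injective; toℕ-inject₁; toℕ-fromℕ )
import Data.Integer.Base as ℤ
open ℤ using (ℤ; +_; 0ℤ; 1ℤ; _◃_)
import Data.Integer.Properties as ℤₚ
open import Data.List.Base using (List; []; _∷_)
open import Data.Nat.Base using (ℕ; zero; suc; _+_; _*_; _<_; s≤s; s≤s⁻¹)
open import Data.Nat.DivMod
  using (_%_; %-distribˡ-+; %-distribˡ-*; m%n%n≡m%n; [m+kn]%n≡m%n; m<n⇒m%n≡m; m%n<n; n%n≡0)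
import Data.Nat.Properties as ℕ
open import Data.Nat.Properties using (allUpTo?)
open import Data.Nat.Tactic.RingSolver using (solve-∀)
open import Data.Product.Base using (Σ; _×_; _,_; proj₁; proj₂; uncurry)
open import Data.Sign.Base as Sign using (Sign)
open import Data.String.Base as String using (String)
open import Data.Sum.Base using (_⊎_; inj₁; inj₂)
open import Function.Base using (_∘_)
open import Relation.Binary.PropositionalEquality
open import Relation.Nullary.Decidable using (yes; no; toWitness)

open import Algebra.Properties.CommutativeSemigroup ℤₚ.*-commutativeSemigroup using (interchange)
open import Algebra.Properties.Semiring.Sum ℤₚ.+-*-semiring
  using (sum; sum-syntax; sum-cong-≗; ∑-distrib-+; *-distribˡ-sum; sum-init-last)

open import Defs

∑≡sum : ∀ n (f : Fin n → ℤ) → ∑ n f ≡ sum f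
∑≡sum zero    f = refl
∑≡sum (suc n) f = cong (ℤ._+_ (f zero)) (∑≡sum n (f ∘ suc))

sum-↑ : ∀ m k (f : Fin (m + k) → ℤ) →
        sum f ≡ sum (λ i → f (i ↑ˡ k)) ℤ.+ sum (λ j → f (m ↑ʳ j))
sum-↑ zero    k f = sym (ℤₚ.+-identityˡ _)
sum-↑ (suc m) k f =
  trans (cong (ℤ._+_ (f zero)) (sum-↑ m k (f ∘ suc))) (sym (ℤₚ.+-assoc (f zero) _ _))

sum-combine : ∀ m k (f : Fin (m * k) → ℤ) →
              sum f ≡ sum (λ p → sum (λ x → f (combine {m} {k} p x)))
sum-combine zero    k f = refl
sum-combine (suc m) k f =
  trans (sum-↑ k (m * k) f)
        (cong (ℤ._+_ (sum (λ x → f (x ↑ˡ (m * k))))) (sum-combine m k (f ∘ (k ↑ʳ_))))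

-- Sums over ℕ-indices evaluate much faster than sums over Fin, whose elements are rebuilt by toℕ.
sumBelow : ℕ → (ℕ → ℤ) → ℤ
sumBelow zero    h = 0ℤ
sumBelow (suc k) h = sumBelow k h ℤ.+ h k

sumBelow-cong : ∀ k {h h′ : ℕ → ℤ} → (∀ w → h w ≡ h′ w) → sumBelow k h ≡ sumBelow k h′
sumBelow-cong zero    h≗h′ = refl
sumBelow-cong (suc k) h≗h′ = cong₂ ℤ._+_ (sumBelow-cong k h≗h′) (h≗h′ k)

sum-toℕ : ∀ k (h : ℕ → ℤ) → ∑[ z < k ] h (toℕ z) ≡ sumBelow k h
sum-toℕ zero    h = refl
sum-toℕ (suc k) h = begin
  ∑[ z < suc k ] h (toℕ z)                             ≡⟨ sum-init-last {k} (h ∘ toℕ) ⟩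
  ∑[ z < k ] h (toℕ (inject₁ z)) ℤ.+ h (toℕ (fromℕ k))
    ≡⟨ cong₂ ℤ._+_ (sum-cong-≗ {k} (cong h ∘ toℕ-inject₁)) (cong h (toℕ-fromℕ k)) ⟩
  ∑[ z < k ] h (toℕ z) ℤ.+ h k                         ≡⟨ cong (ℤ._+ h k) (sum-toℕ k h) ⟩
  sumBelow k h ℤ.+ h k                                 ∎
  where open ≡-Reasoning

data Shape : Set where
  circulant backCirculant : Shape

sameShape : Shape → Shape → Bool
sameShape circulant     circulant     = true
sameShape backCirculant backCirculant = true
sameShape circulant     backCirculant = false
sameShape backCirculant circulant     = false

record Block : Set where
  constructor block
  field
    sign     : ℤ
    shape    : Shape
    sequence : ℕ → ℤ

open Block

IsSign : ℤ → Set
IsSign s = s ≡ 1ℤ ⊎ s ≡ ℤ.- 1ℤ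

IsSign-* : ∀ {a b} → IsSign a → IsSign b → IsSign (a ℤ.* b)
IsSign-* (inj₁ refl) (inj₁ refl) = inj₁ refl
IsSign-* (inj₁ refl) (inj₂ refl) = inj₂ refl
IsSign-* (inj₂ refl) (inj₁ refl) = inj₂ refl
IsSign-* (inj₂ refl) (inj₂ refl) = inj₁ refl

if-split : ∀ b (F : ℕ → ℤ) u v →
           F (if b then u else v) ≡ (if b then F u else 0ℤ) ℤ.+ (if b then 0ℤ else F v)
if-split true  F u v = sym (ℤₚ.+-identityʳ (F u))
if-split false F u v = sym (ℤₚ.+-identityˡ (F v))

identity-≡ : ∀ {k} {i j : Fin k} → i ≡ j → identity i j ≡ 1ℤ
identity-≡ {i = i} {j} i≡j with i ≟ j
... | yes _   = refl
... | no  i≢j = ⊥-elim (i≢j i≡j)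

identity-≢ : ∀ {k} {i j : Fin k} → i ≢ j → identity i j ≡ 0ℤ
identity-≢ {i = i} {j} i≢j with i ≟ j
... | yes i≡j = ⊥-elim (i≢j i≡j)
... | no  _   = refl

-- Indices are read modulo n = suc m, so that multiplication by m is negation.
module Periodic (m : ℕ) where

  n : ℕ
  n = suc m

  a+kn≡b+jn⇒a%n≡b%n : ∀ a b k j → a + k * n ≡ b + j * n → a % n ≡ b % n
  a+kn≡b+jn⇒a%n≡b%n a b k j eq = begin
    a % n           ≡⟨ [m+kn]%n≡m%n a k n ⟨
    (a + k * n) % n ≡⟨ cong (_% n) eq ⟩
    (b + j * n) % n ≡⟨ [m+kn]%n≡m%n b j n ⟩
    b % n           ∎
    where open ≡-Reasoning

  [a%n+b]%n≡[a+b]%n : ∀ a b → (a % n + b) % n ≡ (a + b) % n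
  [a%n+b]%n≡[a+b]%n a b = begin
    (a % n + b) % n         ≡⟨ %-distribˡ-+ (a % n) b n ⟩
    (a % n % n + b % n) % n ≡⟨ cong (λ t → (t + b % n) % n) (m%n%n≡m%n a n) ⟩
    (a % n + b % n) % n     ≡⟨ %-distribˡ-+ a b n ⟨
    (a + b) % n             ∎
    where open ≡-Reasoning

  [a*[b%n]]%n≡[a*b]%n : ∀ a b → (a * (b % n)) % n ≡ (a * b) % n
  [a*[b%n]]%n≡[a*b]%n a b = begin
    (a * (b % n)) % n         ≡⟨ %-distribˡ-* a (b % n) n ⟩
    (a % n * (b % n % n)) % n ≡⟨ cong (λ t → (a % n * t) % n) (m%n%n≡m%n b n) ⟩
    (a % n * (b % n)) % n     ≡⟨ %-distribˡ-* a b n ⟨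
    (a * b) % n               ∎
    where open ≡-Reasoning

  reflect : ℕ → ℕ
  reflect t = (m * t) % n

  _⊖_ : ℕ → ℕ → ℕ
  x ⊖ y = (x + m * y) % n

  _⊕_ : ℕ → ℕ → ℕ
  x ⊕ y = (x + y) % n

  x⊖x≡0 : ∀ x → x ⊖ x ≡ 0
  x⊖x≡0 x = a+kn≡b+jn⇒a%n≡b%n (x + m * x) 0 0 x (rearrange x m)
    where
    rearrange : ∀ x m → x + m * x + 0 * suc m ≡ 0 + x * suc m
    rearrange = solve-∀

  ⊖≡0⇒≡ : ∀ {x y} → x < n → y < n → x ⊖ y ≡ 0 → x ≡ y
  ⊖≡0⇒≡ {x} {y} x<n y<n x⊖y≡0 = begin
    x                   ≡⟨ m<n⇒m%n≡m x<n ⟨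
    x % n               ≡⟨ [m+kn]%n≡m%n x y n ⟨
    (x + y * n) % n     ≡⟨ cong (_% n) (rearrange x y m) ⟩
    (x + m * y + y) % n ≡⟨ [a%n+b]%n≡[a+b]%n (x + m * y) y ⟨
    (x ⊖ y + y) % n     ≡⟨ cong (λ t → (t + y) % n) x⊖y≡0 ⟩
    y % n               ≡⟨ m<n⇒m%n≡m y<n ⟩
    y                   ∎
    where
    open ≡-Reasoning
    rearrange : ∀ x y m → x + y * suc m ≡ x + m * y + y
    rearrange = solve-∀

  sum-rotate : ∀ (G : ℕ → ℤ) → ∑[ z < n ] G (suc (toℕ z) % n) ≡ ∑[ z < n ] G (toℕ z)
  sum-rotate G = begin
    ∑[ z < n ] G (suc (toℕ z) % n)
      ≡⟨ sum-init-last {m} (λ z → G (suc (toℕ z) % n)) ⟩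
    ∑[ i < m ] G (suc (toℕ (inject₁ i)) % n) ℤ.+ G (suc (toℕ (fromℕ m)) % n)
      ≡⟨ cong₂ ℤ._+_ (sum-cong-≗ (cong G ∘ inner)) (cong G last) ⟩
    ∑[ i < m ] G (suc (toℕ i)) ℤ.+ G 0
      ≡⟨ ℤₚ.+-comm _ (G 0) ⟩
    ∑[ z < n ] G (toℕ z) ∎
    where
    open ≡-Reasoning
    inner : ∀ (i : Fin m) → suc (toℕ (inject₁ i)) % n ≡ suc (toℕ i)
    inner i rewrite toℕ-inject₁ i = m<n⇒m%n≡m (s≤s (toℕ<n i))
    last : suc (toℕ (fromℕ m)) % n ≡ 0
    last rewrite toℕ-fromℕ m = n%n≡0 n

  sum-shift : ∀ (G : ℕ → ℤ) s → ∑[ z < n ] G ((toℕ z + s) % n) ≡ ∑[ z < n ] G (toℕ z)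
  sum-shift G zero = sum-cong-≗ (λ z → cong G (begin
    (toℕ z + 0) % n ≡⟨ cong (_% n) (ℕ.+-identityʳ (toℕ z)) ⟩
    toℕ z % n       ≡⟨ m<n⇒m%n≡m (toℕ<n z) ⟩
    toℕ z           ∎))
    where open ≡-Reasoning
  sum-shift G (suc s) = begin
    ∑[ z < n ] G ((toℕ z + suc s) % n)     ≡⟨ sum-cong-≗ (cong G ∘ step) ⟩
    ∑[ z < n ] G′ (suc (toℕ z) % n)        ≡⟨ sum-rotate G′ ⟩
    ∑[ z < n ] G′ (toℕ z)                  ≡⟨ sum-shift G s ⟩
    ∑[ z < n ] G (toℕ z)                   ∎
    where
    open ≡-Reasoning
    G′ : ℕ → ℤ
    G′ k = G ((k + s) % n)
    step : ∀ (z : Fin n) → (toℕ z + suc s) % n ≡ (suc (toℕ z) % n + s) % n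
    step z = trans (cong (_% n) (ℕ.+-suc (toℕ z) s)) (sym ([a%n+b]%n≡[a+b]%n (suc (toℕ z)) s))

  correlation : (ℕ → ℤ) → (ℕ → ℤ) → ℕ → ℤ
  correlation f g t = sumBelow n (λ w → f w ℤ.* g ((w + t) % n))

  correlation-% : ∀ f g t → correlation f g t ≡ correlation f g (t % n)
  correlation-% f g t = sumBelow-cong n λ w → cong (ℤ._*_ (f w) ∘ g) (reduce w)
    where
    open ≡-Reasoning
    reduce : ∀ k → (k + t) % n ≡ (k + t % n) % n
    reduce k = begin
      (k + t) % n     ≡⟨ cong (_% n) (ℕ.+-comm k t) ⟩
      (t + k) % n     ≡⟨ [a%n+b]%n≡[a+b]%n t k ⟨
      (t % n + k) % n ≡⟨ cong (_% n) (ℕ.+-comm (t % n) k) ⟩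
      (k + t % n) % n ∎

  sum-shifted-* : ∀ (f g : ℕ → ℤ) a b →
    ∑[ z < n ] (f ((toℕ z + a) % n) ℤ.* g ((toℕ z + b) % n)) ≡ correlation f g (b + m * a)
  sum-shifted-* f g a b = begin
    ∑[ z < n ] (f ((toℕ z + a) % n) ℤ.* g ((toℕ z + b) % n))
      ≡⟨ sum-cong-≗ {n} (λ z → cong (ℤ._*_ (f ((toℕ z + a) % n)) ∘ g) (realign (toℕ z))) ⟩
    ∑[ z < n ] G ((toℕ z + a) % n) ≡⟨ sum-shift G a ⟩
    ∑[ z < n ] G (toℕ z)           ≡⟨ sum-toℕ n G ⟩
    correlation f g (b + m * a)    ∎
    where
    open ≡-Reasoning
    G : ℕ → ℤ
    G k = f k ℤ.* g ((k + (b + m * a)) % n)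
    rearrange : ∀ z a b m → z + a + (b + m * a) + 0 * suc m ≡ z + b + a * suc m
    rearrange = solve-∀
    realign : ∀ z → (z + b) % n ≡ ((z + a) % n + (b + m * a)) % n
    realign z = sym (trans ([a%n+b]%n≡[a+b]%n (z + a) (b + m * a))
                           (a+kn≡b+jn⇒a%n≡b%n _ _ 0 a (rearrange z a b m)))

  multiplier : Shape → ℕ
  multiplier circulant     = m
  multiplier backCirculant = 1

  entry : Block → ℕ → ℕ → ℤ
  entry b x z = sign b ℤ.* sequence b ((z + multiplier (shape b) * x) % n)

  orient : Shape → ℕ → ℕ
  orient circulant     t = t
  orient backCirculant t = reflect t

  lag : Shape → Shape → ℕ → ℕ → ℕ
  lag s t x y = orient s (if sameShape s t then x ⊖ y else x ⊕ y)

  lag-% : ∀ s t x y → (multiplier t * y + m * (multiplier s * x)) % n ≡ lag s t x y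
  lag-% circulant circulant x y = a+kn≡b+jn⇒a%n≡b%n _ _ x (m * x) (rearrange x y m)
    where
    rearrange : ∀ x y m → m * y + m * (m * x) + x * suc m ≡ x + m * y + m * x * suc m
    rearrange = solve-∀
  lag-% backCirculant backCirculant x y =
    trans (a+kn≡b+jn⇒a%n≡b%n _ _ (m * y) y (rearrange x y m))
          (sym ([a*[b%n]]%n≡[a*b]%n m (x + m * y)))
    where
    rearrange : ∀ x y m → 1 * y + m * (1 * x) + m * y * suc m ≡ m * (x + m * y) + y * suc m
    rearrange = solve-∀
  lag-% circulant backCirculant x y = a+kn≡b+jn⇒a%n≡b%n _ _ x (m * x) (rearrange x y m)
    where
    rearrange : ∀ x y m → 1 * y + m * (m * x) + x * suc m ≡ x + y + m * x * suc m
    rearrange = solve-∀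
  lag-% backCirculant circulant x y =
    trans (cong (_% n) (rearrange x y m)) (sym ([a*[b%n]]%n≡[a*b]%n m (x + y)))
    where
    rearrange : ∀ x y m → m * y + m * (1 * x) ≡ m * (x + y)
    rearrange = solve-∀

  sum-entry-* : ∀ b c x y →
    ∑[ z < n ] (entry b x (toℕ z) ℤ.* entry c y (toℕ z))
      ≡ sign b ℤ.* sign c ℤ.* correlation (sequence b) (sequence c) (lag (shape b) (shape c) x y)
  sum-entry-* b c x y = begin
    ∑[ z < n ] (entry b x (toℕ z) ℤ.* entry c y (toℕ z))
      ≡⟨ sum-cong-≗ {n} (λ z → interchange (sign b) (f (index b x z)) (sign c) (g (index c y z))) ⟩
    ∑[ z < n ] (σ ℤ.* (f (index b x z) ℤ.* g (index c y z)))
      ≡⟨ *-distribˡ-sum σ (λ z → f (index b x z) ℤ.* g (index c y z)) ⟨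
    σ ℤ.* ∑[ z < n ] (f (index b x z) ℤ.* g (index c y z))
      ≡⟨ cong (ℤ._*_ σ) (sum-shifted-* f g _ _) ⟩
    σ ℤ.* correlation f g (multiplier (shape c) * y + m * (multiplier (shape b) * x))
      ≡⟨ cong (ℤ._*_ σ) (correlation-% f g _) ⟩
    σ ℤ.* correlation f g ((multiplier (shape c) * y + m * (multiplier (shape b) * x)) % n)
      ≡⟨ cong (ℤ._*_ σ ∘ correlation f g) (lag-% (shape b) (shape c) x y) ⟩
    σ ℤ.* correlation f g (lag (shape b) (shape c) x y) ∎
    where
    open ≡-Reasoning
    σ : ℤ
    σ = sign b ℤ.* sign c
    f g : ℕ → ℤ
    f = sequence b
    g = sequence c
    index : Block → ℕ → Fin n → ℕ
    index d x z = (toℕ z + multiplier (shape d) * x) % n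

  IsSymmetricSequence : (ℕ → ℤ) → Set
  IsSymmetricSequence f = ∀ {t} → t < n → f t ≡ f (reflect t)

  backCirculant-symmetric : ∀ σ f x z →
    entry (block σ backCirculant f) x z ≡ entry (block σ backCirculant f) z x
  backCirculant-symmetric σ f x z = cong (λ t → σ ℤ.* f (t % n)) (rearrange z x)
    where
    rearrange : ∀ z x → z + 1 * x ≡ x + 1 * z
    rearrange = solve-∀

  circulant-symmetric : ∀ {f} → IsSymmetricSequence f → ∀ σ x z →
    entry (block σ circulant f) x z ≡ entry (block σ circulant f) z x
  circulant-symmetric {f} f-symmetric σ x z = cong (ℤ._*_ σ) (begin
    f ((z + m * x) % n)           ≡⟨ f-symmetric (m%n<n (z + m * x) n) ⟩
    f (reflect ((z + m * x) % n)) ≡⟨ cong f ([a*[b%n]]%n≡[a*b]%n m (z + m * x)) ⟩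
    f ((m * (z + m * x)) % n)     ≡⟨ cong f (a+kn≡b+jn⇒a%n≡b%n _ _ x (m * x) (rearrange z x m)) ⟩
    f ((x + m * z) % n)           ∎)
    where
    open ≡-Reasoning
    rearrange : ∀ z x m → m * (z + m * x) + x * suc m ≡ x + m * z + m * x * suc m
    rearrange = solve-∀

  Array : ℕ → Set
  Array k = Fin k → Fin k → Block

  entryAt : ∀ {k} → Array k → Fin k × Fin n → Fin k × Fin n → ℤ
  entryAt A (p , x) (r , z) = entry (A p r) (toℕ x) (toℕ z)

  toMatrix : ∀ {k} → Array k → Matrix (k * n)
  toMatrix A i j = entryAt A (remQuot n i) (remQuot n j)

  module _ {k} (A : Array k) where

    toMatrix-combine : ∀ (p : Fin k) (x : Fin n) (r : Fin k) (z : Fin n) →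
                       toMatrix A (combine p x) (combine r z) ≡ entry (A p r) (toℕ x) (toℕ z)
    toMatrix-combine p x r z = cong₂ (entryAt A) (remQuot-combine p x) (remQuot-combine r z)

    ∀-combine : {P : Fin (k * n) → Fin (k * n) → Set} →
                (∀ (p : Fin k) (x : Fin n) (q : Fin k) (y : Fin n) → P (combine p x) (combine q y)) →
                ∀ i j → P i j
    ∀-combine {P} h i j = subst₂ P (combine-remQuot {k} n i) (combine-remQuot {k} n j)
                                 (uncurry (uncurry h (remQuot n i)) (remQuot n j))

    toMatrix-±1 : (∀ p r → IsSign (sign (A p r))) → (∀ p r t → IsSign (sequence (A p r) t)) →
                  PlusMinusOne (toMatrix A)
    toMatrix-±1 signs values i j = IsSign-* (signs _ _) (values _ _ _)

    toMatrix-symmetric : (∀ p r → A p r ≡ A r p) →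
                         (∀ p r x z → entry (A p r) x z ≡ entry (A p r) z x) →
                         IsSymmetric (toMatrix A)
    toMatrix-symmetric array-symmetric blocks-symmetric = ∀-combine λ p x r z → begin
      toMatrix A (combine p x) (combine r z)
        ≡⟨ toMatrix-combine p x r z ⟩
      entry (A p r) (toℕ x) (toℕ z)
        ≡⟨ blocks-symmetric p r (toℕ x) (toℕ z) ⟩
      entry (A p r) (toℕ z) (toℕ x)
        ≡⟨ cong (λ c → entry c (toℕ z) (toℕ x)) (array-symmetric p r) ⟩
      entry (A r p) (toℕ z) (toℕ x)
        ≡⟨ toMatrix-combine r z p x ⟨
      toMatrix A (combine r z) (combine p x) ∎
      where open ≡-Reasoning

    gramTerm : Fin k → Fin k → Fin k → ℕ → ℤ
    gramTerm p q r t =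
      sign (A p r) ℤ.* sign (A q r)
        ℤ.* correlation (sequence (A p r)) (sequence (A q r)) (orient (shape (A p r)) t)

    alike : Fin k → Fin k → Fin k → Bool
    alike p q r = sameShape (shape (A p r)) (shape (A q r))

    gramByDifference : Fin k → Fin k → ℕ → ℤ
    gramByDifference p q u = ∑[ r < k ] (if alike p q r then gramTerm p q r u else 0ℤ)

    gramBySum : Fin k → Fin k → ℕ → ℤ
    gramBySum p q v = ∑[ r < k ] (if alike p q r then 0ℤ else gramTerm p q r v)

    gram-combine : ∀ (p : Fin k) (x : Fin n) (q : Fin k) (y : Fin n) →
      (toMatrix A ⊗ transpose (toMatrix A)) (combine p x) (combine q y)
        ≡ gramByDifference p q (toℕ x ⊖ toℕ y) ℤ.+ gramBySum p q (toℕ x ⊕ toℕ y)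
    gram-combine p x q y = begin
      ∑ (k * n) (λ j → toMatrix A (combine p x) j ℤ.* toMatrix A (combine q y) j)
        ≡⟨ ∑≡sum (k * n) _ ⟩
      sum (λ j → toMatrix A (combine p x) j ℤ.* toMatrix A (combine q y) j)
        ≡⟨ sum-combine k n _ ⟩
      ∑[ r < k ] ∑[ z < n ]
        (toMatrix A (combine p x) (combine r z) ℤ.* toMatrix A (combine q y) (combine r z))
        ≡⟨ sum-cong-≗ (λ r → sum-cong-≗ (λ z →
             cong₂ ℤ._*_ (toMatrix-combine p x r z) (toMatrix-combine q y r z))) ⟩
      ∑[ r < k ] ∑[ z < n ] (entry (A p r) (toℕ x) (toℕ z) ℤ.* entry (A q r) (toℕ y) (toℕ z))
        ≡⟨ sum-cong-≗ (λ r → trans (sum-entry-* (A p r) (A q r) (toℕ x) (toℕ y))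
                                   (if-split (alike p q r) (gramTerm p q r) _ _)) ⟩
      ∑[ r < k ] ((if alike p q r then gramTerm p q r (toℕ x ⊖ toℕ y) else 0ℤ)
                   ℤ.+ (if alike p q r then 0ℤ else gramTerm p q r (toℕ x ⊕ toℕ y)))
        ≡⟨ ∑-distrib-+ (λ r → if alike p q r then gramTerm p q r (toℕ x ⊖ toℕ y) else 0ℤ) _ ⟩
      gramByDifference p q (toℕ x ⊖ toℕ y) ℤ.+ gramBySum p q (toℕ x ⊕ toℕ y) ∎
      where open ≡-Reasoning

    identity-combine : ∀ (p q : Fin k) (x : Fin n) → identity (combine p x) (combine q x) ≡ identity p q
    identity-combine p q x with p ≟ q
    ... | yes refl = identity-≡ refl
    ... | no  p≢q  = identity-≢ (p≢q ∘ proj₁ ∘ combine-injective p x q x)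

    toMatrix-gram : (∀ p q → gramByDifference p q 0 ≡ scale (+ (k * n)) identity p q) →
                    (∀ p q {u} → u < m → gramByDifference p q (suc u) ≡ 0ℤ) →
                    (∀ p q {v} → v < n → gramBySum p q v ≡ 0ℤ) →
                    ∀ i j → (toMatrix A ⊗ transpose (toMatrix A)) i j ≡ scale (+ (k * n)) identity i j
    toMatrix-gram diagonal off-diagonal by-sum =
      ∀-combine λ p x q y → trans (gram-combine p x q y) (block-gram p x q y)
      where
      open ≡-Reasoning
      block-gram : ∀ (p : Fin k) (x : Fin n) (q : Fin k) (y : Fin n) →
                   gramByDifference p q (toℕ x ⊖ toℕ y) ℤ.+ gramBySum p q (toℕ x ⊕ toℕ y)
                     ≡ scale (+ (k * n)) identity (combine p x) (combine q y)
      block-gram p x q y with x ≟ y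
      ... | yes refl = begin
        gramByDifference p q (toℕ x ⊖ toℕ x) ℤ.+ gramBySum p q (toℕ x ⊕ toℕ x)
          ≡⟨ cong₂ ℤ._+_ (trans (cong (gramByDifference p q) (x⊖x≡0 (toℕ x))) (diagonal p q))
                         (by-sum p q (m%n<n (toℕ x + toℕ x) n)) ⟩
        + (k * n) ℤ.* identity p q ℤ.+ 0ℤ
          ≡⟨ ℤₚ.+-identityʳ _ ⟩
        + (k * n) ℤ.* identity p q
          ≡⟨ cong (ℤ._*_ (+ (k * n))) (identity-combine p q x) ⟨
        + (k * n) ℤ.* identity (combine p x) (combine q x) ∎
      ... | no x≢y with toℕ x ⊖ toℕ y in x⊖y≡u
      ...   | zero  = ⊥-elim (x≢y (toℕ-injective (⊖≡0⇒≡ (toℕ<n x) (toℕ<n y) x⊖y≡u)))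
      ...   | suc u = begin
        gramByDifference p q (suc u) ℤ.+ gramBySum p q (toℕ x ⊕ toℕ y)
          ≡⟨ cong₂ ℤ._+_ (off-diagonal p q u<m) (by-sum p q (m%n<n (toℕ x + toℕ y) n)) ⟩
        0ℤ
          ≡⟨ ℤₚ.*-zeroʳ (+ (k * n)) ⟨
        + (k * n) ℤ.* 0ℤ
          ≡⟨ cong (ℤ._*_ (+ (k * n))) (identity-≢ (x≢y ∘ proj₂ ∘ combine-injective p x q y)) ⟨
        + (k * n) ℤ.* identity (combine p x) (combine q y) ∎
        where
        u<m : u < m
        u<m = s≤s⁻¹ (subst (_< n) x⊖y≡u (m%n<n (toℕ x + m * toℕ y) n))

    -- The order is a separate N so that, at k * n = 4 * 113, the conclusion can mention 452
    -- literally: converting between 4 * 113 and 452 inside _⊗_ makes Agda unfold the whole sum.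
    symmetricHadamard : ∀ {N} → k * n ≡ N →
      (∀ p r → IsSign (sign (A p r))) → (∀ p r t → IsSign (sequence (A p r) t)) →
      (∀ p r → A p r ≡ A r p) → (∀ p r x z → entry (A p r) x z ≡ entry (A p r) z x) →
      (∀ p q → gramByDifference p q 0 ≡ scale (+ N) identity p q) →
      (∀ p q {u} → u < m → gramByDifference p q (suc u) ≡ 0ℤ) →
      (∀ p q {v} → v < n → gramBySum p q v ≡ 0ℤ) →
      Σ (Matrix N) (λ H → IsSymmetricHadamard N H)
    symmetricHadamard refl signs values array-symmetric blocks-symmetric diagonal off-diagonal by-sum =
      toMatrix A ,
      (toMatrix-±1 signs values , toMatrix-gram diagonal off-diagonal by-sum) ,
      toMatrix-symmetric array-symmetric blocks-symmetric

open Periodic 112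

-- Positions past the end read as +1; only positions below 113 are ever used.
signAt : List Char → ℕ → ℤ
signAt []       _       = 1ℤ
signAt (c ∷ _)  zero    = if primStringEquality (String.fromChar c) "-" then ℤ.- 1ℤ else 1ℤ
signAt (_ ∷ cs) (suc t) = signAt cs t

signAt-±1 : ∀ cs t → IsSign (signAt cs t)
signAt-±1 []       _       = inj₁ refl
signAt-±1 (c ∷ _)  zero    with primStringEquality (String.fromChar c) "-"
... | true  = inj₂ refl
... | false = inj₁ refl
signAt-±1 (_ ∷ cs) (suc t) = signAt-±1 cs t

fromSigns : String → ℕ → ℤ
fromSigns = signAt ∘ String.toList

fromSigns-±1 : ∀ s t → IsSign (fromSigns s t)
fromSigns-±1 s = signAt-±1 (String.toList s)

aSigns bSigns dSigns : String
aSigns = "++-+++-+-+-++---+--+++-+--++++++-+++++------+---+++------------+++---+------+++++-++++++--+-+++--+---++-+-+-+++-+"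
bSigns = "+++--+--+-++-++++-++--+--+-++-+-+---++++++-+---+-+-++++-++-+++++--+--++-++++--+-+++----++--+-+-+--+++--++++--+-+-"
dSigns = "+-+--+--+--+++++-+++-+++++-+-+--+---++---++--++----+++--+++-++++-+---+--+-----+++++----++--+-+-+--+++---++-+--++-"

a b d : ℕ → ℤ
a = fromSigns aSigns
b = fromSigns bSigns
d = fromSigns dSigns

a-symmetric : IsSymmetricSequence a
a-symmetric = toWitness {a? = allUpTo? (λ t → a t ℤₚ.≟ a (reflect t)) n} _

data Generator : Set where
  A B B̄ D D̄ : Generator

shapeOf : Generator → Shape
shapeOf A = circulant
shapeOf _ = backCirculant

sequenceOf : Generator → ℕ → ℤ
sequenceOf A = a
sequenceOf B = b
sequenceOf B̄ = b ∘ reflect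
sequenceOf D = d
sequenceOf D̄ = d ∘ reflect

sequenceOf-±1 : ∀ g t → IsSign (sequenceOf g t)
sequenceOf-±1 A t = fromSigns-±1 aSigns t
sequenceOf-±1 B t = fromSigns-±1 bSigns t
sequenceOf-±1 B̄ t = fromSigns-±1 bSigns (reflect t)
sequenceOf-±1 D t = fromSigns-±1 dSigns t
sequenceOf-±1 D̄ t = fromSigns-±1 dSigns (reflect t)

_·_ : Sign → Generator → Block
s · g = block (s ◃ 1) (shapeOf g) (sequenceOf g)

◃1-±1 : ∀ s → IsSign (s ◃ 1)
◃1-±1 Sign.+ = inj₁ refl
◃1-±1 Sign.- = inj₂ refl

·-symmetric : ∀ s g x z → entry (s · g) x z ≡ entry (s · g) z x
·-symmetric s A = circulant-symmetric a-symmetric (s ◃ 1)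
·-symmetric s B = backCirculant-symmetric (s ◃ 1) b
·-symmetric s B̄ = backCirculant-symmetric (s ◃ 1) (b ∘ reflect)
·-symmetric s D = backCirculant-symmetric (s ◃ 1) d
·-symmetric s D̄ = backCirculant-symmetric (s ◃ 1) (d ∘ reflect)

table : Fin 4 → Fin 4 → Sign × Generator
table 0F 0F = Sign.+ , A
table 0F 1F = Sign.- , B̄
table 0F 2F = Sign.- , B̄
table 0F 3F = Sign.- , D̄
table 1F 0F = Sign.- , B̄
table 1F 1F = Sign.- , D
table 1F 2F = Sign.- , A
table 1F 3F = Sign.+ , B
table 2F 0F = Sign.- , B̄
table 2F 1F = Sign.- , A
table 2F 2F = Sign.+ , D
table 2F 3F = Sign.- , B
table 3F 0F = Sign.- , D̄
table 3F 1F = Sign.+ , B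
table 3F 2F = Sign.- , B
table 3F 3F = Sign.- , A

table-symmetric : ∀ p r → table p r ≡ table r p
table-symmetric 0F 0F = refl
table-symmetric 0F 1F = refl
table-symmetric 0F 2F = refl
table-symmetric 0F 3F = refl
table-symmetric 1F 0F = refl
table-symmetric 1F 1F = refl
table-symmetric 1F 2F = refl
table-symmetric 1F 3F = refl
table-symmetric 2F 0F = refl
table-symmetric 2F 1F = refl
table-symmetric 2F 2F = refl
table-symmetric 2F 3F = refl
table-symmetric 3F 0F = refl
table-symmetric 3F 1F = refl
table-symmetric 3F 2F = refl
table-symmetric 3F 3F = refl

propus : Array 4
propus p r = uncurry _·_ (table p r)

propus-diagonal : ∀ p q → gramByDifference propus p q 0 ≡ scale (+ 452) identity p q
propus-diagonal = toWitness {a? = all? λ p → all? λ q →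
  gramByDifference propus p q 0 ℤₚ.≟ scale (+ 452) identity p q} _

propus-off-diagonal : ∀ p q {u} → u < 112 → gramByDifference propus p q (suc u) ≡ 0ℤ
propus-off-diagonal = toWitness {a? = all? λ p → all? λ q →
  allUpTo? (λ u → gramByDifference propus p q (suc u) ℤₚ.≟ 0ℤ) 112} _

propus-gramBySum : ∀ p q {v} → v < 113 → gramBySum propus p q v ≡ 0ℤ
propus-gramBySum = toWitness {a? = all? λ p → all? λ q →
  allUpTo? (λ v → gramBySum propus p q v ℤₚ.≟ 0ℤ) 113} _

mainTheorem3 : Σ (Matrix 452) (λ H → IsSymmetricHadamard 452 H)
mainTheorem3 = symmetricHadamard propus refl
  (λ p r → ◃1-±1 (proj₁ (table p r))) (λ p r → sequenceOf-±1 (proj₂ (table p r)))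
  (λ p r → cong (uncurry _·_) (table-symmetric p r)) (λ p r → uncurry ·-symmetric (table p r))
  propus-diagonal propus-off-diagonal propus-gramBySum
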